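{- Let $G$ be a finite loopless multigraph, let $m\in\mathbb{N}$, let $\mathcal{H}=(L,H,M)$ be a full $m$-fold cover of $G$, and let $e$ be an edge of $G$ with endpoints $u$ and $v$. Then $$P_{DP}(G,\mathcal{H}) \ge P_{DP}(G-e,\mathcal{H}-e) - P_{DP}(G\cdot e,\mathcal{H}\cdot e).$$ Consequently, $P_{DP}(G-e,m) - P^*_{DP}(G\cdot e,m) \le P_{DP}(G,m)$. Moreover, if for each edge $f\in E_G(u,v)\setminus\{e\}$ no edge of $M(f)$ has the same endpoints as any edge of $M(e)$, then $$P_{DP}(G,\mathcal{H}) = P_{DP}(G-e,\mathcal{H}-e) - P_{DP}(G\cdot e,\mathcal{H}\cdot e).$$ Consequently, when $e_G(u,v)=1$, $P^*_{DP}(G,m) \le P^*_{DP}(G-e,m) - P_{DP}(G\cdot e,m)$.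
   Context: All graphs are finite, nonempty, undirected, loopless multigraphs. For $u,v\in V(G)$, $E_G(u,v)$ is the set of edges with endpoints $u$ and $v$, and $e_G(u,v)=|E_G(u,v)|$. $G-e$ is $G$ with edge $e$ deleted; $G\cdot e$ is obtained by deleting $e$, identifying its endpoints into a single new vertex $w$, and deleting any resulting loops (so the other edges of $E_G(u,v)$ disappear, and each edge of $G\cdot e$ corresponds to exactly one edge of $E(G)\setminus E_G(u,v)$). A cover of a multigraph $G$ is a triple $\mathcal{H}=(L,H,M)$ where $L$ assigns to each $x\in V(G)$ a nonempty finite set $L(x)$, $H$ is a multigraph with vertex set $\bigcup_{x} L(x)$, and $M$ assigns to each $e\in E(G)$ a matching $M(e)$ in $H$ each of whose edges has one endpoint in $L(u)$ and one in $L(v)$, where $u,v$ are the endpoints of $e$; moreover (1) $L(u)\cap L(v)=\emptyset$ for distinct $u,v$; (2) $H[L(u)]$ is a complete graph $K_{|L(u)|}$ for each $u$; (3) $M(e_1)\cap M(e_2)=\emptyset$ for distinct edges $e_1,e_2$; (4) for distinct $u,v$, the set of edges of $H$ between $L(u)$ and $L(v)$ is $\bigcup_{e\in E_G(u,v)}M(e)$. An $\mathcal{H}$-coloring of $G$ is an independent set of $H$ of size $|V(G)|$ (equivalently, an independent set meeting each $L(u)$ in exactly one vertex). $\mathcal{H}$ is $m$-fold if $|L(u)|=m$ for all $u$, and a full $m$-fold cover if additionally the number of edges of $H$ between $L(u)$ and $L(v)$ is $e_G(u,v)\,m$ for all distinct $u,v$ (so each $M(e)$ is a perfect matching). $P_{DP}(G,\mathcal{H})$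 is the number of $\mathcal{H}$-colorings of $G$. For $m\in\mathbb{N}$, the DP color function $P_{DP}(G,m)$ is the minimum, and the dual DP color function $P^*_{DP}(G,m)$ is the maximum, of $P_{DP}(G,\mathcal{H})$ over all full $m$-fold covers $\mathcal{H}$ of $G$. Given a full $m$-fold cover $\mathcal{H}=(L,H,M)$ of $G$ with $L(x)=\{(x,j):j\in[m]\}$ and an edge $e$ with endpoints $u,v$: $\mathcal{H}-e=(L,H-M(e),M')$ where $M'$ is $M$ restricted to $E(G)\setminus\{e\}$; this is a full $m$-fold cover of $G-e$. Let $w$ be the vertex of $G\cdot e$ from contracting $e$. $\mathcal{H}\cdot e=(L',H'',M'')$ where $L'$ agrees with $L$ on $V(G)\setminus\{u,v\}$ and $L'(w)=\{(w,j):j\in[m]\}$; $H''$ is obtained from $H$ by contracting, for each $j\in[m]$, the edge of $M(e)$ with endpoint $(u,j)$ into the vertex $(w,j)$, and then deleting edges so that $H''[L'(w)]$ is $K_m$; $M''(f)=M(f)$ for each edge $f$ of $G\cdot e$ not incident to $w$; if $f$ is incident to $w$ and corresponds to the edge $f'$ of $G$ incident to $u$ (resp. $v$), then $M''(f)$ is obtained from $M(f')$ by replacing the endpoint $(u,j)$ by $(w,j)$ for each $j$ (resp. replacing the endpoint $(v,j)$ by $(w,j')$, where $(u,j')$ is the other endpoint of the edge of $M(e)$ containing $(v,j)$). This is a full $m$-fold cover of $G\cdot e$. -}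

module Defs where

open import Data.Nat using (ℕ; zero; suc; _+_)
open import Data.Fin using (Fin; punchOut)
open import Data.Fin.Properties using (_≟_; all?; any?)
open import Data.Fin.Permutation using (Permutation′; _⟨$⟩ʳ_; _⟨$⟩ˡ_; _∘ₚ_; flip; id)
open import Data.Vec using (Vec; []; _∷_; lookup)
open import Data.List using (List; []; _∷_; [_]; map; concatMap; length; filter; allFin; sum)
import Data.List as List
open import Data.Product using (Σ; _×_; _,_; proj₁; proj₂)
open import Data.Sum using (_⊎_)
open import Data.Bool using (Bool; true; false; if_then_else_; not)
open import Relation.Nullary using (¬_; yes; no; Dec; _×-dec_; _⊎-dec_; ¬?)
open import Relation.Nullary.Decidable using (⌊_⌋)
open import Relation.Binary.PropositionalEquality using (_≡_; _≢_; sym)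
open import Data.Integer using (ℤ; +_; _-_) renaming (_≤_ to _≤ℤ_)
import Data.Nat as ℕ

-- Edges are indexed by Fin nE;
-- edge f has endpoints  src f  and  tgt f  (the orientation is only a
-- bookkeeping device used to describe the matching M(f), see Cover).

record Multigraph (n : ℕ) : Set where
  field
    nE  : ℕ
    src : Fin nE → Fin n
    tgt : Fin nE → Fin n
open Multigraph public

Loopless : ∀ {n} → Multigraph n → Set
Loopless G = ∀ f → src G f ≢ tgt G f

Joins : ∀ {n} (G : Multigraph n) → Fin (nE G) → Fin n → Fin n → Set
Joins G f x y = (src G f ≡ x × tgt G f ≡ y) ⊎ (src G f ≡ y × tgt G f ≡ x)

joins? : ∀ {n} (G : Multigraph n) f x y → Dec (Joins G f x y)
joins? G f x y = ((src G f ≟ x) ×-dec (tgt G f ≟ y)) ⊎-dec ((src G f ≟ y) ×-dec (tgt G f ≟ x))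

eG : ∀ {n} (G : Multigraph n) → Fin n → Fin n → ℕ
eG G x y = length (filter (λ f → joins? G f x y) (allFin (nE G)))

-- L(x) = {(x,j) : j ∈ Fin m}; H[L(x)] = K_m; for an
-- edge f, M(f) is a perfect matching between L(src f) and L(tgt f),
-- given by a permutation σ_f :  M(f) = { (src f, j)(tgt f, σ_f j) }.
-- By (4) these data determine H, so a full m-fold cover is exactly an
-- assignment of a permutation of Fin m to every edge.

Cover : ∀ {n} → Multigraph n → ℕ → Set
Cover G m = Fin (nE G) → Permutation′ m

VH : ℕ → ℕ → Set
VH n m = Fin n × Fin m

MEdge : ∀ {n m} (G : Multigraph n) → Cover G m → Fin (nE G) → VH n m → VH n m → Set
MEdge G σ f (x , i) (y , j) =
    (src G f ≡ x × tgt G f ≡ y × σ f ⟨$⟩ʳ i ≡ j)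
  ⊎ (src G f ≡ y × tgt G f ≡ x × σ f ⟨$⟩ʳ j ≡ i)

-- Adjacency in H (condition (2): K_m on each L(x); condition (4): the
-- edges between L(x) and L(y) are the union of the M(f))
AdjH : ∀ {n m} (G : Multigraph n) → Cover G m → VH n m → VH n m → Set
AdjH G σ (x , i) (y , j) =
  (x ≡ y × i ≢ j) ⊎ Σ (Fin (nE G)) (λ f → MEdge G σ f (x , i) (y , j))

-- An H-coloring: an independent set of H meeting each L(x) in exactly
-- one vertex, i.e. a choice c(x) ∈ L(x) for every x with no two chosen
-- vertices adjacent in H.
IsColoring : ∀ {n m} (G : Multigraph n) → Cover G m → Vec (Fin m) n → Set
IsColoring {n} G σ c = ∀ (x y : Fin n) → ¬ AdjH G σ (x , lookup c x) (y , lookup c y)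

allVecs : (n m : ℕ) → List (Vec (Fin m) n)
allVecs zero    m = [ [] ]
allVecs (suc n) m = concatMap (λ i → map (i ∷_) (allVecs n m)) (allFin m)

mEdge? : ∀ {n m} (G : Multigraph n) (σ : Cover G m) f p q → Dec (MEdge G σ f p q)
mEdge? G σ f (x , i) (y , j) =
  ((src G f ≟ x) ×-dec (tgt G f ≟ y) ×-dec (σ f ⟨$⟩ʳ i ≟ j))
  ⊎-dec ((src G f ≟ y) ×-dec (tgt G f ≟ x) ×-dec (σ f ⟨$⟩ʳ j ≟ i))

adjH? : ∀ {n m} (G : Multigraph n) (σ : Cover G m) p q → Dec (AdjH G σ p q)
adjH? G σ (x , i) (y , j) =
  ((x ≟ y) ×-dec ¬? (i ≟ j)) ⊎-dec any? (λ f → mEdge? G σ f (x , i) (y , j))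

isColoring? : ∀ {n m} (G : Multigraph n) (σ : Cover G m) c → Dec (IsColoring G σ c)
isColoring? G σ c =
  all? (λ x → all? (λ y → ¬? (adjH? G σ (x , lookup c x) (y , lookup c y))))

PDP : ∀ {n m} (G : Multigraph n) → Cover G m → ℕ
PDP {n} {m} G σ = length (filter (isColoring? G σ) (allVecs n m))

IsPDP : ∀ {n} → Multigraph n → ℕ → ℕ → Set
IsPDP G m p = Σ (Cover G m) (λ σ → PDP G σ ≡ p) × (∀ (σ : Cover G m) → p ℕ.≤ PDP G σ)

IsPDP* : ∀ {n} → Multigraph n → ℕ → ℕ → Set
IsPDP* G m p = Σ (Cover G m) (λ σ → PDP G σ ≡ p) × (∀ (σ : Cover G m) → PDP G σ ℕ.≤ p)

restrict : ∀ {n} (G : Multigraph n) → List (Fin (nE G)) → Multigraph n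
restrict G ks = record
  { nE  = length ks
  ; src = λ j → src G (List.lookup ks j)
  ; tgt = λ j → tgt G (List.lookup ks j) }

delKeep : ∀ {n} (G : Multigraph n) → Fin (nE G) → List (Fin (nE G))
delKeep G e = filter (λ f → ¬? (f ≟ e)) (allFin (nE G))

_-ᴳ_ : ∀ {n} (G : Multigraph n) → Fin (nE G) → Multigraph n
G -ᴳ e = restrict G (delKeep G e)

delCover : ∀ {n m} (G : Multigraph n) (e : Fin (nE G)) → Cover G m → Cover (G -ᴳ e) m
delCover G e σ j = σ (List.lookup (delKeep G e) j)

-- The new vertex set is Fin n: v is removed and u
-- becomes the new vertex w; the other vertices are renumbered by punchOut.

module _ {n : ℕ} (G : Multigraph (suc n)) (e : Fin (nE G))
         (u≢v : src G e ≢ tgt G e) where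

  private
    u v : Fin (suc n)
    u = src G e
    v = tgt G e

  conV : Fin (suc n) → Fin n
  conV x with x ≟ v
  ... | yes _   = punchOut {i = v} {j = u} (λ p → u≢v (sym p))
  ... | no x≢v  = punchOut {i = v} {j = x} (λ p → x≢v (sym p))

  conKeep : List (Fin (nE G))
  conKeep = filter (λ f → ¬? (joins? G f u v)) (allFin (nE G))

  contract : Multigraph n
  contract = record
    { nE  = length conKeep
    ; src = λ j → conV (src G (List.lookup conKeep j))
    ; tgt = λ j → conV (tgt G (List.lookup conKeep j)) }

  -- relabelling of the layers: (x , j) ↦ (conV x , relabel x ⟨$⟩ʳ j);
  -- identity except on L(v), where (v , j) ↦ (w , j') with (u , j')(v , j) ∈ M(e)
  module _ {m : ℕ} (σ : Cover G m) where
    relabel : Fin (suc n) → Permutation′ m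
    relabel x with x ≟ v
    ... | yes _ = flip (σ e)
    ... | no  _ = id

    -- H · e : the edge (a , i)(b , σ_f i) of M(f) becomes
    -- (conV a , relabel a i)(conV b , relabel b (σ_f i))
    contractCover : Cover contract m
    contractCover j =
      let f = List.lookup conKeep j in
      flip (relabel (src G f)) ∘ₚ σ f ∘ₚ relabel (tgt G f)

{-# OPTIONS --safe #-}

-- Every H-colouring of G is an (H-e)-colouring, and the (H-e)-colourings that are
-- not H-colourings are those c that pick both ends (u,j)(v,σₑ j) of an edge of M(e).
-- Forgetting c(v) and giving the contracted vertex w the colour j maps these
-- injectively to (H·e)-colourings, so P(G-e) = P(G) + #conflicts ≤ P(G) + P(G·e).
-- An (H·e)-colouring fails to lift back only if c then conflicts at an edge f ≠ e
-- parallel to e, i.e. M(f) contains (u,j)(v,σₑ j); when no M(f) shares an edge with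
-- M(e) the map is a bijection and equality holds.  The bounds on P_DP and P*_DP follow
-- by evaluating at extremal covers, and e_G(u,v) = 1 leaves no parallel edges.

module Submission where

open import Defs
import Data.Nat.Properties as ℕ
open import Algebra.Properties.CommutativeSemigroup ℕ.+-commutativeSemigroup
  using (interchange)
open import Data.Empty using (⊥-elim)
open import Data.Fin using (Fin; zero; suc; punchOut)
open import Data.Fin.Permutation using (Permutation′; _⟨$⟩ʳ_; _⟨$⟩ˡ_; inverseˡ)
open import Function.Properties.Inverse using (↔⇒↣)
open import Data.Fin.Properties using (_≟_; suc-injective; punchIn-punchOut)
open import Data.Integer using (+_; _-_; _≤_)
open import Data.Integer.Properties using ([+m]-[+n]≡m⊖n; ⊖-≥; ⊖-monoˡ-≤; ⊖-monoʳ-≥-≤)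
import Data.Integer.Properties as ℤ
open import Data.List using (List; []; _∷_; _++_; map; concatMap; filter; length; tabulate; allFin)
import Data.List as List
open import Data.List.Membership.Propositional using (_∈_)
open import Data.List.Membership.Propositional.Properties using (∈-filter⁺; ∈-filter⁻; ∈-allFin; ∈-lookup)
open import Data.List.Relation.Unary.Any using (here; there; index)
open import Data.List.Relation.Unary.Any.Properties using (lookup-index)
open import Data.Nat using (ℕ; zero; suc; _+_; z≤n) renaming (_≤_ to _≤ℕ_)
open import Data.Nat.Properties
  using (+-assoc; +-identityʳ; +-mono-≤; m≤n+m; m+n∸n≡m; ≤-refl; module ≤-Reasoning)
open import Data.Product using (∃-syntax; _×_; _,_; proj₁; proj₂)
open import Data.Sum using (inj₁; inj₂)
open import Data.Vec using (Vec; _∷_; lookup; insertAt)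
open import Data.Vec.Properties using (insertAt-lookup; insertAt-punchIn)
open import Function using (_∘_; id)
open import Function.Bundles using (_⇔_; mk⇔; Equivalence; Injection)
open import Function.Construct.Identity using (⇔-id)
open import Relation.Nullary using (¬_; Dec; yes; no; _×-dec_; ¬?)
open import Relation.Unary using (Decidable)
open import Relation.Binary.PropositionalEquality
  using (_≡_; _≢_; refl; sym; trans; cong; cong₂; subst; module ≡-Reasoning)

open Equivalence using (to; from)

private
  variable
    A B : Set
    P Q R : Set
    n n′ m : ℕ

-- Counting by sums of indicators

∑ : List A → (A → ℕ) → ℕ
∑ []       f = 0
∑ (x ∷ xs) f = f x + ∑ xs f

∑-cong : ∀ (xs : List A) {f g : A → ℕ} → (∀ x → f x ≡ g x) → ∑ xs f ≡ ∑ xs g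
∑-cong []       f≡g = refl
∑-cong (x ∷ xs) f≡g = cong₂ _+_ (f≡g x) (∑-cong xs f≡g)

∑-mono-≤ : ∀ (xs : List A) {f g : A → ℕ} → (∀ x → f x ≤ℕ g x) → ∑ xs f ≤ℕ ∑ xs g
∑-mono-≤ []       f≤g = z≤n
∑-mono-≤ (x ∷ xs) f≤g = +-mono-≤ (f≤g x) (∑-mono-≤ xs f≤g)

∑-zero : ∀ (xs : List A) → ∑ xs (λ _ → 0) ≡ 0
∑-zero []       = refl
∑-zero (x ∷ xs) = ∑-zero xs

∑-distrib-+ : ∀ (xs : List A) (f g : A → ℕ) → ∑ xs (λ x → f x + g x) ≡ ∑ xs f + ∑ xs g
∑-distrib-+ []       f g = refl
∑-distrib-+ (x ∷ xs) f g =
  trans (cong (_+_ (f x + g x)) (∑-distrib-+ xs f g)) (interchange (f x) (g x) (∑ xs f) (∑ xs g))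

∑-++ : ∀ (xs ys : List A) (f : A → ℕ) → ∑ (xs ++ ys) f ≡ ∑ xs f + ∑ ys f
∑-++ []       ys f = refl
∑-++ (x ∷ xs) ys f = trans (cong (_+_ (f x)) (∑-++ xs ys f)) (sym (+-assoc (f x) _ _))

∑-map : ∀ (xs : List A) (g : A → B) (f : B → ℕ) → ∑ (map g xs) f ≡ ∑ xs (f ∘ g)
∑-map []       g f = refl
∑-map (x ∷ xs) g f = cong (_+_ (f (g x))) (∑-map xs g f)

∑-concatMap : ∀ (xs : List A) (g : A → List B) (f : B → ℕ) →
              ∑ (concatMap g xs) f ≡ ∑ xs (λ x → ∑ (g x) f)
∑-concatMap []       g f = refl
∑-concatMap (x ∷ xs) g f =
  trans (∑-++ (g x) (concatMap g xs) f) (cong (_+_ (∑ (g x) f)) (∑-concatMap xs g f))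

∑-comm : ∀ (xs : List A) (ys : List B) (h : A → B → ℕ) →
         ∑ xs (λ x → ∑ ys (h x)) ≡ ∑ ys (λ y → ∑ xs (λ x → h x y))
∑-comm []       ys h = sym (∑-zero ys)
∑-comm (x ∷ xs) ys h = trans (cong (_+_ (∑ ys (h x))) (∑-comm xs ys h)) (sym (∑-distrib-+ ys (h x) _))

∑-tabulate-zero : ∀ (g : Fin n → A) {f : A → ℕ} → (∀ i → f (g i) ≡ 0) → ∑ (tabulate g) f ≡ 0
∑-tabulate-zero {n = zero}  g f∘g≡0 = refl
∑-tabulate-zero {n = suc n} g f∘g≡0 =
  cong₂ _+_ (f∘g≡0 zero) (∑-tabulate-zero (g ∘ suc) (f∘g≡0 ∘ suc))

∑-tabulate-single : ∀ (g : Fin n → A) {f : A → ℕ} (i₀ : Fin n) →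
                    (∀ i → i ≢ i₀ → f (g i) ≡ 0) → ∑ (tabulate g) f ≡ f (g i₀)
∑-tabulate-single {n = suc n} g zero     vanish =
  trans (cong (_+_ _) (∑-tabulate-zero (g ∘ suc) (λ i → vanish (suc i) λ ())))
        (+-identityʳ _)
∑-tabulate-single {n = suc n} g (suc i₀) vanish =
  cong₂ _+_ (vanish zero λ ())
            (∑-tabulate-single (g ∘ suc) i₀ (λ i i≢i₀ → vanish (suc i) (i≢i₀ ∘ suc-injective)))

𝟙 : Dec P → ℕ
𝟙 (yes _) = 1
𝟙 (no  _) = 0

length-filter≡∑𝟙 : ∀ {P : A → Set} (P? : Decidable P) xs → length (filter P? xs) ≡ ∑ xs (𝟙 ∘ P?)
length-filter≡∑𝟙 P? []       = refl
length-filter≡∑𝟙 P? (x ∷ xs) with P? x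
... | yes _ = cong suc (length-filter≡∑𝟙 P? xs)
... | no  _ = length-filter≡∑𝟙 P? xs

𝟙-no : ¬ P → (p : Dec P) → 𝟙 p ≡ 0
𝟙-no ¬p (yes p) = ⊥-elim (¬p p)
𝟙-no ¬p (no  _) = refl

𝟙-mono : (P → Q) → (p : Dec P) (q : Dec Q) → 𝟙 p ≤ℕ 𝟙 q
𝟙-mono P→Q (yes p) (yes _) = ≤-refl
𝟙-mono P→Q (yes p) (no ¬q) = ⊥-elim (¬q (P→Q p))
𝟙-mono P→Q (no  _) q       = z≤n

𝟙-cong : P ⇔ Q → (p : Dec P) (q : Dec Q) → 𝟙 p ≡ 𝟙 q
𝟙-cong P⇔Q (yes p) (yes _) = refl
𝟙-cong P⇔Q (yes p) (no ¬q) = ⊥-elim (¬q (to P⇔Q p))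
𝟙-cong P⇔Q (no ¬p) (yes q) = ⊥-elim (¬p (from P⇔Q q))
𝟙-cong P⇔Q (no  _) (no  _) = refl

𝟙-partition : P ⇔ (Q × ¬ R) → (p : Dec P) (q : Dec Q) (r : Dec R) → 𝟙 q ≡ 𝟙 p + 𝟙 (q ×-dec r)
𝟙-partition P⇔Q×¬R p (no ¬q) r = sym (cong (_+ 0) (𝟙-no (¬q ∘ proj₁ ∘ to P⇔Q×¬R) p))
𝟙-partition P⇔Q×¬R p (yes q) (yes r) = cong (_+ 1) (sym (𝟙-no (λ p′ → proj₂ (to P⇔Q×¬R p′) r) p))
𝟙-partition P⇔Q×¬R p (yes q) (no ¬r) =
  trans (𝟙-cong (mk⇔ (λ _ → from P⇔Q×¬R (q , ¬r)) (proj₁ ∘ to P⇔Q×¬R)) (yes q) p) (sym (+-identityʳ _))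

∑-allVecs-suc : ∀ n (h : Vec (Fin m) (suc n) → ℕ) →
                ∑ (allVecs (suc n) m) h ≡ ∑ (allFin m) (λ i → ∑ (allVecs n m) (h ∘ (i ∷_)))
∑-allVecs-suc {m = m} n h =
  trans (∑-concatMap (allFin m) _ h) (∑-cong (allFin m) (λ i → ∑-map (allVecs n m) (i ∷_) h))

∑-allVecs-insertAt : ∀ n (v : Fin (suc n)) (h : Vec (Fin m) (suc n) → ℕ) →
                     ∑ (allVecs (suc n) m) h ≡
                     ∑ (allVecs n m) (λ b → ∑ (allFin m) (λ i → h (insertAt b v i)))
∑-allVecs-insertAt {m = m} n zero h =
  trans (∑-allVecs-suc n h) (∑-comm (allFin m) (allVecs n m) _)
∑-allVecs-insertAt {m = m} (suc n) (suc v) h = begin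
  ∑ (allVecs (suc (suc n)) m) h
    ≡⟨ ∑-allVecs-suc (suc n) h ⟩
  ∑ (allFin m) (λ x → ∑ (allVecs (suc n) m) (h ∘ (x ∷_)))
    ≡⟨ ∑-cong (allFin m) (λ x → ∑-allVecs-insertAt n v (h ∘ (x ∷_))) ⟩
  ∑ (allFin m) (λ x → ∑ (allVecs n m) (λ b → ∑ (allFin m) (λ i → h (x ∷ insertAt b v i))))
    ≡⟨ ∑-allVecs-suc n (λ b → ∑ (allFin m) (λ i → h (insertAt b (suc v) i))) ⟨
  ∑ (allVecs (suc n) m) (λ b → ∑ (allFin m) (λ i → h (insertAt b (suc v) i)))
    ∎
  where open ≡-Reasoning

lookup-filter-allFin : ∀ {k} {P : Fin k → Set} (P? : Decidable P) j →
                       P (List.lookup (filter P? (allFin k)) j)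
lookup-filter-allFin {k} P? j = proj₂ (∈-filter⁻ P? {xs = allFin k} (∈-lookup j))

lookup-filter-allFin-surjective : ∀ {k} {P : Fin k → Set} (P? : Decidable P) {f} → P f →
                                  ∃[ j ] List.lookup (filter P? (allFin k)) j ≡ f
lookup-filter-allFin-surjective P? {f} Pf =
  index f∈ , sym (lookup-index f∈)
  where f∈ = ∈-filter⁺ P? (∈-allFin f) Pf

length≡1⇒∈-unique : ∀ (xs : List A) {x y} → length xs ≡ 1 → x ∈ xs → y ∈ xs → x ≡ y
length≡1⇒∈-unique (_ ∷ [])    _ (here refl) (here refl) = refl
length≡1⇒∈-unique (_ ∷ [])    _ (here _)    (there ())
length≡1⇒∈-unique (_ ∷ [])    _ (there ())  _
length≡1⇒∈-unique (_ ∷ _ ∷ _) () _ _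

Conflict : (G : Multigraph n) → Cover G m → Vec (Fin m) n → Fin (nE G) → Set
Conflict G σ c f = σ f ⟨$⟩ʳ lookup c (src G f) ≡ lookup c (tgt G f)

conflict? : ∀ (G : Multigraph n) (σ : Cover G m) c f → Dec (Conflict G σ c f)
conflict? G σ c f = σ f ⟨$⟩ʳ lookup c (src G f) ≟ lookup c (tgt G f)

module _ (G : Multigraph n) (σ : Cover G m) (c : Vec (Fin m) n) where

  isColoring⇒¬conflict : IsColoring G σ c → ∀ f → ¬ Conflict G σ c f
  isColoring⇒¬conflict col f conflict = col (src G f) (tgt G f) (inj₂ (f , inj₁ (refl , refl , conflict)))

  ¬conflict⇒isColoring : (∀ f → ¬ Conflict G σ c f) → IsColoring G σ c
  ¬conflict⇒isColoring ok x .x (inj₁ (refl , i≢i)) = i≢i refl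
  ¬conflict⇒isColoring ok _ _  (inj₂ (f , inj₁ (refl , refl , conflict))) = ok f conflict
  ¬conflict⇒isColoring ok _ _  (inj₂ (f , inj₂ (refl , refl , conflict))) = ok f conflict

  conflict⇒MEdge : ∀ {f x y} → Joins G f x y → Conflict G σ c f →
                   MEdge G σ f (x , lookup c x) (y , lookup c y)
  conflict⇒MEdge (inj₁ (refl , refl)) conflict = inj₁ (refl , refl , conflict)
  conflict⇒MEdge (inj₂ (refl , refl)) conflict = inj₂ (refl , refl , conflict)

isColoring⇔ : ∀ (G : Multigraph n) (σ : Cover G m) c {G′ : Multigraph n′} (τ : Cover G′ m) b
              {P : Fin (nE G) → Set} (ι : Fin (nE G′) → Fin (nE G)) →
              (∀ j → P (ι j)) → (∀ {f} → P f → ∃[ j ] ι j ≡ f) →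
              (∀ j → Conflict G′ τ b j ⇔ Conflict G σ c (ι j)) →
              IsColoring G′ τ b ⇔ (∀ f → P f → ¬ Conflict G σ c f)
isColoring⇔ G σ c {G′} τ b ι ι-into ι-onto conflict⇔ = mk⇔
  (λ col f Pf → let (j , ιj≡f) = ι-onto Pf in
     subst (¬_ ∘ Conflict G σ c) ιj≡f (isColoring⇒¬conflict G′ τ b col j ∘ from (conflict⇔ j)))
  (λ ok → ¬conflict⇒isColoring G′ τ b (λ j → ok (ι j) (ι-into j) ∘ to (conflict⇔ j)))

-- Deletion

module Deletion (G : Multigraph n) (e : Fin (nE G)) (σ : Cover G m) where

  Gᵈ : Multigraph n
  Gᵈ = G -ᴳ e

  σᵈ : Cover Gᵈ m
  σᵈ = delCover G e σ

  isColoring-delete⇔ : ∀ c → IsColoring Gᵈ σᵈ c ⇔ (∀ f → f ≢ e → ¬ Conflict G σ c f)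
  isColoring-delete⇔ c = isColoring⇔ G σ c σᵈ c (List.lookup (delKeep G e))
    (lookup-filter-allFin ≢e?) (lookup-filter-allFin-surjective ≢e?) (λ _ → ⇔-id _)
    where ≢e? = λ f → ¬? (f ≟ e)

  isColoring⇔isColoring-delete×¬conflict : ∀ c → IsColoring G σ c ⇔ (IsColoring Gᵈ σᵈ c × ¬ Conflict G σ c e)
  isColoring⇔isColoring-delete×¬conflict c = mk⇔
    (λ col → from (isColoring-delete⇔ c) (λ f _ → isColoring⇒¬conflict G σ c col f) ,
             isColoring⇒¬conflict G σ c col e)
    (λ (del , ¬conflict) → ¬conflict⇒isColoring G σ c (ok del ¬conflict))
    where
    ok : IsColoring Gᵈ σᵈ c → ¬ Conflict G σ c e → ∀ f → ¬ Conflict G σ c f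
    ok del ¬conflict f with f ≟ e
    ... | yes refl = ¬conflict
    ... | no  f≢e  = to (isColoring-delete⇔ c) del f f≢e

  conflicting? : Decidable (λ c → IsColoring Gᵈ σᵈ c × Conflict G σ c e)
  conflicting? c = isColoring? Gᵈ σᵈ c ×-dec conflict? G σ c e

  conflictCount : ℕ
  conflictCount = length (filter conflicting? (allVecs n m))

  PDP-delete : PDP Gᵈ σᵈ ≡ PDP G σ + conflictCount
  PDP-delete = begin
    PDP Gᵈ σᵈ
      ≡⟨ length-filter≡∑𝟙 (isColoring? Gᵈ σᵈ) cs ⟩
    ∑ cs (𝟙 ∘ isColoring? Gᵈ σᵈ)
      ≡⟨ ∑-cong cs (λ c → 𝟙-partition (isColoring⇔isColoring-delete×¬conflict c)
                                       (isColoring? G σ c) (isColoring? Gᵈ σᵈ c) (conflict? G σ c e)) ⟩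
    ∑ cs (λ c → 𝟙 (isColoring? G σ c) + 𝟙 (conflicting? c))
      ≡⟨ ∑-distrib-+ cs _ _ ⟩
    ∑ cs (𝟙 ∘ isColoring? G σ) + ∑ cs (𝟙 ∘ conflicting?)
      ≡⟨ cong₂ _+_ (length-filter≡∑𝟙 (isColoring? G σ) cs) (length-filter≡∑𝟙 conflicting? cs) ⟨
    PDP G σ + conflictCount
      ∎
    where
    open ≡-Reasoning
    cs = allVecs n m

-- Contraction

ParallelMatchingsDisjoint : (G : Multigraph n) → Cover G m → Fin (nE G) → Set
ParallelMatchingsDisjoint {m = m} G σ e =
  ∀ f → f ≢ e → Joins G f (src G e) (tgt G e) →
  ∀ (j : Fin m) → ¬ MEdge G σ f (src G e , j) (tgt G e , σ e ⟨$⟩ʳ j)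

module Contraction {n} (G : Multigraph (suc n)) (e : Fin (nE G)) (u≢v : src G e ≢ tgt G e)
                   {m} (σ : Cover G m) where

  open Deletion G e σ

  private
    u v : Fin (suc n)
    u = src G e
    v = tgt G e

  Gᶜ : Multigraph n
  Gᶜ = contract G e u≢v

  σᶜ : Cover Gᶜ m
  σᶜ = contractCover G e u≢v σ

  private
    ρ : Fin (suc n) → Permutation′ m
    ρ = relabel G e u≢v σ

  w : Fin n
  w = punchOut (u≢v ∘ sym)

  -- inverse of the contraction on colour vectors that conflict at e
  expand : Vec (Fin m) n → Vec (Fin m) (suc n)
  expand b = insertAt b v (σ e ⟨$⟩ʳ lookup b w)

  lookup-insertAt-u : ∀ (b : Vec (Fin m) n) i → lookup (insertAt b v i) u ≡ lookup b w
  lookup-insertAt-u b i =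
    trans (cong (lookup (insertAt b v i)) (sym (punchIn-punchOut (u≢v ∘ sym)))) (insertAt-punchIn b v i w)

  conflict-expand : ∀ b → Conflict G σ (expand b) e
  conflict-expand b = trans (cong (σ e ⟨$⟩ʳ_) (lookup-insertAt-u b i₀)) (sym (insertAt-lookup b v i₀))
    where i₀ = σ e ⟨$⟩ʳ lookup b w

  conflict-insertAt⇒ : ∀ (b : Vec (Fin m) n) i → Conflict G σ (insertAt b v i) e → i ≡ σ e ⟨$⟩ʳ lookup b w
  conflict-insertAt⇒ b i conflict =
    trans (sym (insertAt-lookup b v i)) (trans (sym conflict) (cong (σ e ⟨$⟩ʳ_) (lookup-insertAt-u b i)))

  lookup-conV : ∀ b x → lookup b (conV G e u≢v x) ≡ ρ x ⟨$⟩ʳ lookup (expand b) x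
  lookup-conV b x with x ≟ v
  ... | yes refl = sym (trans (cong (σ e ⟨$⟩ˡ_) (insertAt-lookup b v _)) (inverseˡ (σ e)))
  ... | no  x≢v  = sym (trans (cong (lookup (expand b)) (sym (punchIn-punchOut (x≢v ∘ sym))))
                              (insertAt-punchIn b v _ _))

  conflict-contract⇔ : ∀ b j → Conflict Gᶜ σᶜ b j ⇔ Conflict G σ (expand b) (List.lookup (conKeep G e u≢v) j)
  conflict-contract⇔ b j = mk⇔
    (λ conflict → Injection.injective (↔⇒↣ (ρ y)) (trans (sym σᶜ-lookup) (trans conflict (lookup-conV b y))))
    (λ conflict → trans σᶜ-lookup (trans (cong (ρ y ⟨$⟩ʳ_) conflict) (sym (lookup-conV b y))))
    where
    f = List.lookup (conKeep G e u≢v) j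
    x = src G f
    y = tgt G f
    σᶜ-lookup : σᶜ j ⟨$⟩ʳ lookup b (conV G e u≢v x) ≡ ρ y ⟨$⟩ʳ (σ f ⟨$⟩ʳ lookup (expand b) x)
    σᶜ-lookup = trans (cong (λ z → ρ y ⟨$⟩ʳ (σ f ⟨$⟩ʳ (ρ x ⟨$⟩ˡ z))) (lookup-conV b x))
                      (cong (λ z → ρ y ⟨$⟩ʳ (σ f ⟨$⟩ʳ z)) (inverseˡ (ρ x)))

  isColoring-contract⇔ : ∀ b → IsColoring Gᶜ σᶜ b ⇔ (∀ f → ¬ Joins G f u v → ¬ Conflict G σ (expand b) f)
  isColoring-contract⇔ b = isColoring⇔ G σ (expand b) σᶜ b (List.lookup (conKeep G e u≢v))
    (lookup-filter-allFin ∦?) (lookup-filter-allFin-surjective ∦?) (conflict-contract⇔ b)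
    where ∦? = λ f → ¬? (joins? G f u v)

  isColoring-expand⇒isColoring-contract : ∀ b → IsColoring Gᵈ σᵈ (expand b) → IsColoring Gᶜ σᶜ b
  isColoring-expand⇒isColoring-contract b del = from (isColoring-contract⇔ b) λ f ¬joins →
    to (isColoring-delete⇔ (expand b)) del f (λ { refl → ¬joins (inj₁ (refl , refl)) })

  -- a conflict at a parallel edge f would make M(f) contain (u,j)(v,σₑ j)
  isColoring-contract⇒isColoring-expand : ParallelMatchingsDisjoint G σ e → ∀ b →
                                           IsColoring Gᶜ σᶜ b → IsColoring Gᵈ σᵈ (expand b)
  isColoring-contract⇒isColoring-expand disjoint b col = from (isColoring-delete⇔ (expand b)) ok
    where
    ok : ∀ f → f ≢ e → ¬ Conflict G σ (expand b) f
    ok f f≢e conflict with joins? G f u v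
    ... | no  ¬joins = to (isColoring-contract⇔ b) col f ¬joins conflict
    ... | yes joins  = disjoint f f≢e joins (lookup (expand b) u)
            (subst (MEdge G σ f (u , lookup (expand b) u) ∘ (v ,_)) (sym (conflict-expand b))
                   (conflict⇒MEdge G σ (expand b) joins conflict))

  conflictCount≡∑expand : conflictCount ≡ ∑ (allVecs n m) (𝟙 ∘ isColoring? Gᵈ σᵈ ∘ expand)
  conflictCount≡∑expand = begin
    conflictCount
      ≡⟨ length-filter≡∑𝟙 conflicting? (allVecs (suc n) m) ⟩
    ∑ (allVecs (suc n) m) (𝟙 ∘ conflicting?)
      ≡⟨ ∑-allVecs-insertAt n v (𝟙 ∘ conflicting?) ⟩
    ∑ (allVecs n m) (λ b → ∑ (allFin m) (𝟙 ∘ conflicting? ∘ insertAt b v))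
      ≡⟨ ∑-cong (allVecs n m) single ⟩
    ∑ (allVecs n m) (𝟙 ∘ isColoring? Gᵈ σᵈ ∘ expand)
      ∎
    where
    open ≡-Reasoning
    single : ∀ b → ∑ (allFin m) (𝟙 ∘ conflicting? ∘ insertAt b v) ≡ 𝟙 (isColoring? Gᵈ σᵈ (expand b))
    single b = trans
      (∑-tabulate-single id _ (λ i i≢ → 𝟙-no (i≢ ∘ conflict-insertAt⇒ b i ∘ proj₂) _))
      (𝟙-cong (mk⇔ proj₁ (λ del → del , conflict-expand b)) _ _)

  conflictCount≤PDP-contract : conflictCount ≤ℕ PDP Gᶜ σᶜ
  conflictCount≤PDP-contract = begin
    conflictCount                                    ≡⟨ conflictCount≡∑expand ⟩
    ∑ (allVecs n m) (𝟙 ∘ isColoring? Gᵈ σᵈ ∘ expand) ≤⟨ ∑-mono-≤ (allVecs n m) lift ⟩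
    ∑ (allVecs n m) (𝟙 ∘ isColoring? Gᶜ σᶜ)          ≡⟨ length-filter≡∑𝟙 (isColoring? Gᶜ σᶜ) (allVecs n m) ⟨
    PDP Gᶜ σᶜ                                        ∎
    where
    open ≤-Reasoning
    lift = λ b → 𝟙-mono (isColoring-expand⇒isColoring-contract b) _ _

  conflictCount≡PDP-contract : ParallelMatchingsDisjoint G σ e → conflictCount ≡ PDP Gᶜ σᶜ
  conflictCount≡PDP-contract disjoint = begin
    conflictCount                                    ≡⟨ conflictCount≡∑expand ⟩
    ∑ (allVecs n m) (𝟙 ∘ isColoring? Gᵈ σᵈ ∘ expand) ≡⟨ ∑-cong (allVecs n m) lift ⟩
    ∑ (allVecs n m) (𝟙 ∘ isColoring? Gᶜ σᶜ)          ≡⟨ length-filter≡∑𝟙 (isColoring? Gᶜ σᶜ) (allVecs n m) ⟨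
    PDP Gᶜ σᶜ                                        ∎
    where
    open ≡-Reasoning
    lift = λ b → 𝟙-cong (mk⇔ (isColoring-expand⇒isColoring-contract b)
                               (isColoring-contract⇒isColoring-expand disjoint b)) _ _

+[m+n]-+n≡+m : ∀ a x → + (a + x) - + x ≡ + a
+[m+n]-+n≡+m a x = trans ([+m]-[+n]≡m⊖n (a + x) x) (trans (⊖-≥ (m≤n+m x a)) (cong +_ (m+n∸n≡m a x)))

[+m]-[+n]-mono-≤ : ∀ {a a′ b b′} → a ≤ℕ a′ → b′ ≤ℕ b → + a - + b ≤ + a′ - + b′
[+m]-[+n]-mono-≤ {a} {a′} {b} {b′} a≤a′ b′≤b
  rewrite [+m]-[+n]≡m⊖n a b | [+m]-[+n]≡m⊖n a′ b′ = ℤ.≤-trans (⊖-monoˡ-≤ b a≤a′) (⊖-monoʳ-≥-≤ a′ b′≤b)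

eG≡1⇒parallelMatchingsDisjoint : ∀ (G : Multigraph n) (σ : Cover G m) e →
  eG G (src G e) (tgt G e) ≡ 1 → ParallelMatchingsDisjoint G σ e
eG≡1⇒parallelMatchingsDisjoint G σ e eG≡1 f f≢e joins _ _ =
  f≢e (length≡1⇒∈-unique _ eG≡1 (∈-filter⁺ parallel? (∈-allFin f) joins)
                                  (∈-filter⁺ parallel? (∈-allFin e) (inj₁ (refl , refl))))
  where parallel? = λ g → joins? G g (src G e) (tgt G e)

module _ {n} (G : Multigraph (suc n)) (e : Fin (nE G)) (u≢v : src G e ≢ tgt G e) {m : ℕ} where

  PDP-delete-contract-≤ : ∀ (σ : Cover G m) →
    + PDP (G -ᴳ e) (delCover G e σ) - + PDP (contract G e u≢v) (contractCover G e u≢v σ) ≤ + PDP G σ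
  PDP-delete-contract-≤ σ = begin
    + PDP Gᵈ σᵈ - + PDP Gᶜ σᶜ
      ≤⟨ [+m]-[+n]-mono-≤ (ℕ.≤-reflexive PDP-delete) conflictCount≤PDP-contract ⟩
    + (PDP G σ + conflictCount) - + conflictCount
      ≡⟨ +[m+n]-+n≡+m (PDP G σ) conflictCount ⟩
    + PDP G σ
      ∎
    where
    open Deletion G e σ
    open Contraction G e u≢v σ
    open ℤ.≤-Reasoning

  PDP-delete-contract : ∀ (σ : Cover G m) → ParallelMatchingsDisjoint G σ e →
    + PDP G σ ≡ + PDP (G -ᴳ e) (delCover G e σ) - + PDP (contract G e u≢v) (contractCover G e u≢v σ)
  PDP-delete-contract σ disjoint = begin
    + PDP G σ
      ≡⟨ +[m+n]-+n≡+m (PDP G σ) conflictCount ⟨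
    + (PDP G σ + conflictCount) - + conflictCount
      ≡⟨ cong₂ (λ d c → + d - + c) (sym PDP-delete) (conflictCount≡PDP-contract disjoint) ⟩
    + PDP Gᵈ σᵈ - + PDP Gᶜ σᶜ
      ∎
    where
    open Deletion G e σ
    open Contraction G e u≢v σ
    open ≡-Reasoning

  IsPDP-delete-contract-≤ : ∀ {a b c} → IsPDP (G -ᴳ e) m a → IsPDP* (contract G e u≢v) m b → IsPDP G m c →
                            + a - + b ≤ + c
  IsPDP-delete-contract-≤ {a} {b} {c} (_ , a≤) (_ , ≤b) ((σ , PDP≡c) , _) = begin
    + a - + b
      ≤⟨ [+m]-[+n]-mono-≤ (a≤ (delCover G e σ)) (≤b (contractCover G e u≢v σ)) ⟩
    + PDP (G -ᴳ e) (delCover G e σ) - + PDP (contract G e u≢v) (contractCover G e u≢v σ)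
      ≤⟨ PDP-delete-contract-≤ σ ⟩
    + PDP G σ
      ≡⟨ cong +_ PDP≡c ⟩
    + c
      ∎
    where open ℤ.≤-Reasoning

  IsPDP*-≤-delete-contract : eG G (src G e) (tgt G e) ≡ 1 → ∀ {a b c} →
                             IsPDP* G m a → IsPDP* (G -ᴳ e) m b → IsPDP (contract G e u≢v) m c →
                             + a ≤ + b - + c
  IsPDP*-≤-delete-contract eG≡1 {a} {b} {c} ((σ , PDP≡a) , _) (_ , ≤b) (_ , c≤) = begin
    + a
      ≡⟨ cong +_ PDP≡a ⟨
    + PDP G σ
      ≡⟨ PDP-delete-contract σ (eG≡1⇒parallelMatchingsDisjoint G σ e eG≡1) ⟩
    + PDP (G -ᴳ e) (delCover G e σ) - + PDP (contract G e u≢v) (contractCover G e u≢v σ)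
      ≤⟨ [+m]-[+n]-mono-≤ (≤b (delCover G e σ)) (c≤ (contractCover G e u≢v σ)) ⟩
    + b - + c
      ∎
    where open ℤ.≤-Reasoning

theorem3 : (n : ℕ) (G : Multigraph (suc n)) (loopless : Loopless G)
    (m : ℕ) → 1 Data.Nat.≤ m → (e : Fin (nE G)) →
    -- P_DP(G,H) ≥ P_DP(G-e,H-e) - P_DP(G·e,H·e)
    (∀ (σ : Cover G m) →
      + PDP (G -ᴳ e) (delCover G e σ) - + PDP (contract G e (loopless e)) (contractCover G e (loopless e) σ)
        ≤ + PDP G σ)
    ×
    -- P_DP(G-e,m) - P*_DP(G·e,m) ≤ P_DP(G,m)
    (∀ (a b c : ℕ) → IsPDP (G -ᴳ e) m a → IsPDP* (contract G e (loopless e)) m b → IsPDP G m c →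
      + a - + b ≤ + c)
    ×
    -- equality under the matching condition on the other edges of E_G(u,v)
    (∀ (σ : Cover G m) →
      (∀ (f : Fin (nE G)) → f ≢ e → Joins G f (src G e) (tgt G e) →
         ∀ (j : Fin m) → ¬ MEdge G σ f (src G e , j) (tgt G e , σ e ⟨$⟩ʳ j)) →
      + PDP G σ ≡ + PDP (G -ᴳ e) (delCover G e σ) - + PDP (contract G e (loopless e)) (contractCover G e (loopless e) σ))
    ×
    -- if e_G(u,v) = 1 then P*_DP(G,m) ≤ P*_DP(G-e,m) - P_DP(G·e,m)
    (eG G (src G e) (tgt G e) ≡ 1 →
      ∀ (a b c : ℕ) → IsPDP* G m a → IsPDP* (G -ᴳ e) m b → IsPDP (contract G e (loopless e)) m c →
        + a ≤ + b - + c)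
-- the argument does not use m ≥ 1
theorem3 n G loopless m _ e =
  PDP-delete-contract-≤ G e (loopless e) ,
  (λ _ _ _ → IsPDP-delete-contract-≤ G e (loopless e)) ,
  PDP-delete-contract G e (loopless e) ,
  (λ eG≡1 _ _ _ → IsPDP*-≤-delete-contract G e (loopless e) eG≡1)
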